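{- Let $\mathbf{s}=(s_1,\dots,s_n)$ be a sequence of positive integers and $\mathbf{s}^*=(s_1,\dots,s_n,1)$. Then for each $i$, \[\mathcal{L}^i(\operatorname{Par}_{\mathbf{s}^*})=\{\mathbf{x}\in\operatorname{Par}_{\mathbf{s}^*}\cap\mathbb{Z}^{n+1}:\operatorname{des}_{\mathbf{s}^*}(\operatorname{REM}_{\mathbf{s}^*}(\mathbf{x}))=i\}=\{\operatorname{REM}_{\mathbf{s}^*}^{ -1}(\mathbf{r}):\mathbf{r}\in\Psi_n\times\langle0\rangle,\ \operatorname{des}_{\mathbf{s}^*}(\mathbf{r})=i\},\] and $\ell^i(\operatorname{Par}_{\mathbf{s}^*})=\#\{\mathbf{r}\in\Psi_n\times\langle0\rangle:\operatorname{des}_{\mathbf{s}^*}(\mathbf{r})=i\}$.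
   Context: $\langle N\rangle=\{0,\dots,N\}$, $\Psi_n=\langle s_1-1\rangle\times\cdots\times\langle s_n-1\rangle$. For a sequence $\mathbf{t}=(t_1,\dots,t_m)$ of positive integers, $\operatorname{Par}_{\mathbf{t}}=\{\sum_{j=1}^m c_j\mathbf{w}_j:0\le c_j<1\}$ with $\mathbf{w}_j=(0,\dots,0,t_j,\dots,t_m)$ ($j-1$ leading zeros); $\operatorname{REM}_{\mathbf{t}}:\operatorname{Par}_{\mathbf{t}}\cap\mathbb{Z}^m\to\langle t_1-1\rangle\times\cdots\times\langle t_m-1\rangle$ maps $\mathbf{x}$ to the vector of remainders of $x_i$ modulo $t_i$, and is a bijection; $\operatorname{des}_{\mathbf{t}}(\mathbf{r})=\#\{i\in\{1,\dots,m-1\}:r_i/t_i>r_{i+1}/t_{i+1}\}$. $\mathcal{L}^i(S)$ is the set of lattice points of $S$ with last coordinate $i$, $\ell^i(S)=\#\mathcal{L}^i(S)$. -}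

module Defs where

open import Data.Bool using (Bool; true; false; if_then_else_)
open import Data.Nat as ℕ using (ℕ; zero; suc; NonZero; _≤ᵇ_)
open import Data.Fin using (Fin; zero; suc; toℕ; inject₁)
open import Data.Vec using (Vec; []; _∷_; lookup; tabulate; _∷ʳ_; last)
open import Data.Integer as ℤ using (ℤ; +_; _%ℕ_)
open import Data.Rational as ℚ using (ℚ; _/_; 0ℚ; 1ℚ)
open import Data.Rational.Properties using (_<?_)
open import Data.List using (List; length)
open import Data.List.Membership.Propositional using (_∈_)
open import Data.List.Relation.Unary.Unique.Propositional using (Unique)
open import Data.Product using (Σ; _×_)
open import Function.Bundles using (_⇔_)
open import Relation.Nullary using (does)
open import Relation.Binary.PropositionalEquality using (_≡_)

Positive : ∀ {m} → Vec ℕ m → Set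
Positive {m} t = (k : Fin m) → NonZero (lookup t k)

positive-∷ʳ1 : ∀ {n} (s : Vec ℕ n) → Positive s → Positive (s ∷ʳ 1)
positive-∷ʳ1 []      pos zero    = _
positive-∷ʳ1 (a ∷ s) pos zero    = pos zero
positive-∷ʳ1 (a ∷ s) pos (suc k) = positive-∷ʳ1 s (λ j → pos (suc j)) k

sumℚ : ∀ {m} → (Fin m → ℚ) → ℚ
sumℚ {zero}  f = 0ℚ
sumℚ {suc m} f = f zero ℚ.+ sumℚ (λ j → f (suc j))

-- w_j = (0,…,0,t_j,…,t_m) : coordinate k of w_j is t_k if j ≤ k, else 0
w : ∀ {m} → Vec ℕ m → Fin m → Fin m → ℚ
w t j k = if toℕ j ≤ᵇ toℕ k then (+ lookup t k) / 1 else 0ℚ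

-- An integer point x ∈ ℤ^m lies in Par_t = { Σ_j c_j w_j : 0 ≤ c_j < 1 }.
-- (Coefficients are taken rational: for an integer point the coefficients
--  are uniquely determined and rational.)
InPar : ∀ {m} → Vec ℕ m → Vec ℤ m → Set
InPar {m} t x =
  Σ (Fin m → ℚ) λ c →
    ((j : Fin m) → (0ℚ ℚ.≤ c j) × (c j ℚ.< 1ℚ)) ×
    ((k : Fin m) → (lookup x k) / 1 ≡ sumℚ (λ j → c j ℚ.* w t j k))

REM : ∀ {m} (t : Vec ℕ m) → Positive t → Vec ℤ m → Vec ℕ m
REM t pos x = tabulate λ k → _%ℕ_ (lookup x k) (lookup t k) {{pos k}}

countFin : ∀ {m} → (Fin m → Bool) → ℕ
countFin {zero}  p = 0
countFin {suc m} p = (if p zero then 1 else 0) ℕ.+ countFin (λ j → p (suc j))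

des : ∀ {m} (t : Vec ℕ m) → Positive t → Vec ℕ m → ℕ
des {zero}  t pos r = 0
des {suc m} t pos r = countFin {m} λ i → does (q (suc i) <? q (inject₁ i))
  where
  q : Fin (suc m) → ℚ
  q k = _/_ (+ lookup r k) (lookup t k) {{pos k}}

-- r ∈ Ψ_n × ⟨0⟩ = ⟨s_1 - 1⟩ × ⋯ × ⟨s_n - 1⟩ × ⟨0⟩
InΨ×0 : ∀ {n} → Vec ℕ n → Vec ℕ (suc n) → Set
InΨ×0 {n} s r = ((k : Fin n) → lookup r (inject₁ k) ℕ.< lookup s k) × (last r ≡ 0)

HasCard : ∀ {A : Set} → (A → Set) → ℕ → Set
HasCard {A} P k = Σ (List A) λ L → Unique L × ((a : A) → (a ∈ L) ⇔ P a) × (length L ≡ k)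

module Submission where

-- Write an integer point as x_k = r_k + a_k t_k with 0 ≤ r_k < t_k.  Since
-- x = Σ_j c_j w_j means x_k / t_k = c_1 + ⋯ + c_k, the point x lies in Par_t iff
-- the rescaled coordinates q_k = a_k + r_k/t_k have all increments in [0,1).
-- A carry argument shows that q_{k+1} - q_k ∈ [0,1) iff a_{k+1} = a_k + [r_{k+1}/t_{k+1} < r_k/t_k],
-- so x ∈ Par_t iff a_k counts the descents of r = REM_t(x) before position k.
-- Consequently REM_t is a bijection from Par_t ∩ ℤ^m onto the box of remainder
-- vectors, with inverse lift (IntegerPoints).  For t = s* the last modulus is 1,
-- so the last coordinate of x is exactly des_{s*}(REM x), and the box is Ψ_n × ⟨0⟩.
-- The corollary follows, the cardinality statement by transporting an explicit
-- enumeration of {r ∈ Ψ_n × ⟨0⟩ : des_{s*}(r) = i} along lift.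

open import Defs
open import Data.Bool using (Bool; if_then_else_)
open import Data.Nat as ℕ using (ℕ; zero; suc; NonZero)
import Data.Nat.Properties as ℕP
import Data.Nat.DivMod as ℕD
open import Data.Integer as ℤ using (ℤ; +_; -[1+_]; _%ℕ_; _/ℕ_)
import Data.Integer.DivMod as ℤD
import Data.Integer.Properties as ℤP
open import Data.Integer.Tactic.RingSolver using (solve-∀)
open import Data.Rational as ℚ using (ℚ; _/_; 0ℚ; 1ℚ; toℚᵘ)
import Data.Rational.Properties as ℚP
open import Data.Rational.Solver using (module +-*-Solver)
open import Data.Rational.Unnormalised as ℚᵘ using (ℚᵘ; mkℚᵘ; *≡*; *<*)
import Data.Rational.Unnormalised.Properties as ℚᵘP
open import Data.Fin using (Fin; zero; suc; inject₁; fromℕ)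
open import Data.Fin.Induction using (<-weakInduction)
open import Data.Vec using (Vec; []; _∷_; lookup; tabulate; _∷ʳ_; last)
import Data.Vec.Properties as VecP
open import Data.Product using (Σ; _×_; _,_; proj₁; proj₂; ∃)
open import Function using (_∘_)
open import Function.Bundles using (_⇔_; mk⇔; Equivalence)
open import Function.Properties.Equivalence using () renaming (trans to ⇔-trans; sym to ⇔-sym)
open import Relation.Nullary using (Dec; does; yes; no)
open import Relation.Unary using (Decidable)
open import Relation.Binary.PropositionalEquality
open import Data.List using (List; []; _∷_; length; map; filter; upTo; cartesianProductWith)
open import Data.List.Properties using (length-map; map-∘; map-id-local)
open import Data.List.Membership.Propositional using (_∈_)
open import Data.List.Membership.Propositional.Properties
  using (∈-filter⁺; ∈-filter⁻; ∈-map⁺; ∈-map⁻; ∈-upTo⁺; ∈-upTo⁻;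
         ∈-cartesianProductWith⁺; ∈-cartesianProductWith⁻)
open import Data.List.Relation.Unary.Any using (here)
import Data.List.Relation.Unary.All as All
import Data.List.Relation.Unary.AllPairs as AllPairs
open import Data.List.Relation.Unary.Unique.Propositional using (Unique)
import Data.List.Relation.Unary.Unique.Propositional.Properties as UniqueP

ι : ℤ → ℚ
ι z = z / 1

toℚᵘ-/ : ∀ z d → toℚᵘ (z / suc d) ℚᵘ.≃ mkℚᵘ z d
toℚᵘ-/ z d = ℚP.toℚᵘ-fromℚᵘ (mkℚᵘ z d)

-- An equality of rationals may be checked on unnormalised representatives,
-- where it becomes an integer identity (cross-multiplication).
≡-via-ℚᵘ : ∀ {p q} (u v : ℚᵘ) → toℚᵘ p ℚᵘ.≃ u → toℚᵘ q ℚᵘ.≃ v → u ℚᵘ.≃ v → p ≡ q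
≡-via-ℚᵘ u v p≃u q≃v u≃v =
  ℚP.toℚᵘ-injective (ℚᵘP.≃-trans p≃u (ℚᵘP.≃-trans u≃v (ℚᵘP.≃-sym q≃v)))

ι-+ : ∀ a b → ι (a ℤ.+ b) ≡ ι a ℚ.+ ι b
ι-+ a b = ≡-via-ℚᵘ (mkℚᵘ (a ℤ.+ b) 0) (mkℚᵘ a 0 ℚᵘ.+ mkℚᵘ b 0) (toℚᵘ-/ _ 0)
  (ℚᵘP.≃-trans (ℚP.toℚᵘ-homo-+ (ι a) (ι b)) (ℚᵘP.+-cong (toℚᵘ-/ a 0) (toℚᵘ-/ b 0)))
  (*≡* (identity a b))
  where
  identity : ∀ a b → (a ℤ.+ b) ℤ.* + 1 ≡ (a ℤ.* + 1 ℤ.+ b ℤ.* + 1) ℤ.* + 1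
  identity = solve-∀

ι-neg : ∀ a → ι (ℤ.- a) ≡ ℚ.- ι a
ι-neg a = ≡-via-ℚᵘ (mkℚᵘ (ℤ.- a) 0) (mkℚᵘ (ℤ.- a) 0) (toℚᵘ-/ _ 0)
  (ℚᵘP.≃-trans (ℚP.toℚᵘ-homo‿- (ι a)) (ℚᵘP.-‿cong (toℚᵘ-/ a 0))) ℚᵘP.≃-refl

ι-- : ∀ a b → ι (a ℤ.- b) ≡ ι a ℚ.- ι b
ι-- a b = trans (ι-+ a (ℤ.- b)) (cong (ι a ℚ.+_) (ι-neg b))

ι-cancel-< : ∀ {a b} → ι a ℚ.< ι b → a ℤ.< b
ι-cancel-< {a} {b} a<b
  with ℚᵘP.<-respʳ-≃ (toℚᵘ-/ b 0) (ℚᵘP.<-respˡ-≃ (toℚᵘ-/ a 0) (ℚP.toℚᵘ-mono-< a<b))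
... | *<* a*1<b*1 = subst₂ ℤ._<_ (ℤP.*-identityʳ a) (ℤP.*-identityʳ b) a*1<b*1

ι≡T*fraction : ∀ z T .{{_ : NonZero T}} → ι z ≡ ι (+ T) ℚ.* (z / T)
ι≡T*fraction z (suc d) = ≡-via-ℚᵘ (mkℚᵘ z 0) (mkℚᵘ (+ suc d) 0 ℚᵘ.* mkℚᵘ z d) (toℚᵘ-/ z 0)
  (ℚᵘP.≃-trans (ℚP.toℚᵘ-homo-* (ι (+ suc d)) (z / suc d))
               (ℚᵘP.*-cong (toℚᵘ-/ (+ suc d) 0) (toℚᵘ-/ z d)))
  (*≡* (trans (cong (λ e → z ℤ.* + suc e) (ℕP.+-identityʳ d)) (identity z (+ suc d))))
  where
  identity : ∀ z T → z ℤ.* T ≡ (T ℤ.* z) ℤ.* + 1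
  identity = solve-∀

fraction-split : ∀ a r T .{{_ : NonZero T}} → (+ r ℤ.+ a ℤ.* + T) / T ≡ ι a ℚ.+ (+ r / T)
fraction-split a r (suc d) =
  ≡-via-ℚᵘ (mkℚᵘ (+ r ℤ.+ a ℤ.* + suc d) d) (mkℚᵘ a 0 ℚᵘ.+ mkℚᵘ (+ r) d) (toℚᵘ-/ _ d)
    (ℚᵘP.≃-trans (ℚP.toℚᵘ-homo-+ (ι a) (+ r / suc d)) (ℚᵘP.+-cong (toℚᵘ-/ a 0) (toℚᵘ-/ (+ r) d)))
    (*≡* (trans (cong (λ e → (+ r ℤ.+ a ℤ.* + suc d) ℤ.* + suc e) (ℕP.+-identityʳ d))
                (identity a (+ r) (+ suc d))))
  where
  identity : ∀ a r T → (r ℤ.+ a ℤ.* T) ℤ.* T ≡ (a ℤ.* T ℤ.+ r ℤ.* + 1) ℤ.* T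
  identity = solve-∀

T*-injective : ∀ T .{{_ : NonZero T}} {p q} → ι (+ T) ℚ.* p ≡ ι (+ T) ℚ.* q → p ≡ q
T*-injective T@(suc _) Tp≡Tq = ℚP.≤-antisym (cancel Tp≡Tq) (cancel (sym Tp≡Tq))
  where
  instance
    T>0 : ℚ.Positive (ι (+ T))
    T>0 = ℚP.normalize-pos T 1
  cancel : ∀ {p q} → ι (+ T) ℚ.* p ≡ ι (+ T) ℚ.* q → p ℚ.≤ q
  cancel eq = ℚP.*-cancelˡ-≤-pos (ι (+ T)) (ℚP.≤-reflexive eq)

InUnit : ℚ → Set
InUnit p = 0ℚ ℚ.≤ p × p ℚ.< 1ℚ

InUnit-resp : ∀ {p q} → p ≡ q → InUnit p ⇔ InUnit q
InUnit-resp p≡q = mk⇔ (subst InUnit p≡q) (subst InUnit (sym p≡q))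

fraction-inUnit : ∀ r T .{{_ : NonZero T}} → r ℕ.< T → InUnit (+ r / T)
fraction-inUnit r T@(suc d) r<T = ℚP.nonNegative⁻¹ _ {{ℚP.normalize-nonNeg r T}} ,
  ℚP.toℚᵘ-cancel-< (ℚᵘP.<-respˡ-≃ (ℚᵘP.≃-sym (toℚᵘ-/ (+ r) d))
    (*<* (subst₂ ℤ._<_ (sym (ℤP.*-identityʳ (+ r))) (sym (ℤP.*-identityˡ (+ T))) (ℤ.+<+ r<T))))

between-0-and-1 : ∀ {k} → + 0 ℤ.< k ℤ.+ + 1 → k ℤ.< + 1 → k ≡ + 0
between-0-and-1 {+ 0}          _           _                   = refl
between-0-and-1 {+ suc n}      _           (ℤ.+<+ (ℕ.s≤s ()))
between-0-and-1 { -[1+ 0 ]}    (ℤ.+<+ ())  _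
between-0-and-1 { -[1+ suc n ]} ()         _

shift-inUnit : ∀ {g} → InUnit g → ∀ k → InUnit (ι k ℚ.+ g) ⇔ (k ≡ + 0)
shift-inUnit {g} (0≤g , g<1) k = mk⇔ to from
  where
  to : InUnit (ι k ℚ.+ g) → k ≡ + 0
  to (0≤k+g , k+g<1) = between-0-and-1 (ι-cancel-< 0<k+1) (ι-cancel-< k<1)
    where
    k<1 : ι k ℚ.< ι (+ 1)
    k<1 = ℚP.≤-<-trans (subst (ℚ._≤ ι k ℚ.+ g) (ℚP.+-identityʳ (ι k)) (ℚP.+-monoʳ-≤ (ι k) 0≤g))
                       k+g<1
    0<k+1 : ι (+ 0) ℚ.< ι (k ℤ.+ + 1)
    0<k+1 = ℚP.≤-<-trans 0≤k+g
              (subst (ι k ℚ.+ g ℚ.<_) (sym (ι-+ k (+ 1))) (ℚP.+-monoʳ-< (ι k) g<1))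
  from : k ≡ + 0 → InUnit (ι k ℚ.+ g)
  from refl = subst InUnit (sym (ℚP.+-identityˡ g)) (0≤g , g<1)

bit : Bool → ℕ
bit b = if b then 1 else 0

borrow-inUnit : ∀ {f f'} → InUnit f → InUnit f' → (f'<?f : Dec (f' ℚ.< f)) →
  InUnit ((f' ℚ.- f) ℚ.+ ι (+ bit (does f'<?f)))
borrow-inUnit {f} {f'} (0≤f , f<1) (0≤f' , f'<1) (yes f'<f) =
  ℚP.<⇒≤ (ℚP.+-monoˡ-< 1ℚ -1<f'-f) , ℚP.+-monoˡ-< 1ℚ f'-f<0
  where
  -1<f'-f : ℚ.- 1ℚ ℚ.< f' ℚ.- f
  -1<f'-f = ℚP.+-mono-≤-< 0≤f' (ℚP.neg-antimono-< f<1)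
  f'-f<0 : f' ℚ.- f ℚ.< 0ℚ
  f'-f<0 = subst (f' ℚ.- f ℚ.<_) (ℚP.+-inverseʳ f) (ℚP.+-monoˡ-< (ℚ.- f) f'<f)
borrow-inUnit {f} {f'} (0≤f , f<1) (0≤f' , f'<1) (no f'≮f) =
  subst InUnit (sym (ℚP.+-identityʳ (f' ℚ.- f))) (0≤f'-f , ℚP.≤-<-trans f'-f≤f' f'<1)
  where
  0≤f'-f : 0ℚ ℚ.≤ f' ℚ.- f
  0≤f'-f = subst (ℚ._≤ f' ℚ.- f) (ℚP.+-inverseʳ f) (ℚP.+-monoˡ-≤ (ℚ.- f) (ℚP.≮⇒≥ f'≮f))
  f'-f≤f' : f' ℚ.- f ℚ.≤ f'
  f'-f≤f' = subst (f' ℚ.- f ℚ.≤_) (ℚP.+-identityʳ f') (ℚP.+-monoʳ-≤ f' (ℚP.neg-antimono-≤ 0≤f))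

carry : ∀ a a' {f f'} → InUnit f → InUnit f' →
  InUnit ((ι a' ℚ.+ f') ℚ.- (ι a ℚ.+ f)) ⇔ (a' ≡ a ℤ.+ + bit (does (f' ℚP.<? f)))
carry a a' {f} {f'} f∈ f'∈ =
  ⇔-trans (InUnit-resp split)
    (⇔-trans (shift-inUnit (borrow-inUnit f∈ f'∈ (f' ℚP.<? f)) (a' ℤ.- c))
             (mk⇔ (ℤP.i-j≡0⇒i≡j a' c) λ { refl → ℤP.+-inverseʳ c }))
  where
  b : ℕ
  b = bit (does (f' ℚP.<? f))
  c : ℤ
  c = a ℤ.+ + b
  open +-*-Solver
  split : (ι a' ℚ.+ f') ℚ.- (ι a ℚ.+ f) ≡ ι (a' ℤ.- c) ℚ.+ ((f' ℚ.- f) ℚ.+ ι (+ b))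
  split = begin
    (ι a' ℚ.+ f') ℚ.- (ι a ℚ.+ f)
      ≡⟨ solve 5 (λ A' A B F F' → (A' :+ F') :- (A :+ F) := (A' :- (A :+ B)) :+ ((F' :- F) :+ B))
               refl (ι a') (ι a) (ι (+ b)) f f' ⟩
    (ι a' ℚ.- (ι a ℚ.+ ι (+ b))) ℚ.+ ((f' ℚ.- f) ℚ.+ ι (+ b))
      ≡⟨ cong (λ v → (ι a' ℚ.- v) ℚ.+ ((f' ℚ.- f) ℚ.+ ι (+ b))) (sym (ι-+ a (+ b))) ⟩
    (ι a' ℚ.- ι c) ℚ.+ ((f' ℚ.- f) ℚ.+ ι (+ b))
      ≡⟨ cong (ℚ._+ ((f' ℚ.- f) ℚ.+ ι (+ b))) (sym (ι-- a' c)) ⟩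
    ι (a' ℤ.- c) ℚ.+ ((f' ℚ.- f) ℚ.+ ι (+ b)) ∎
    where open ≡-Reasoning

partialSum : ∀ {m} → (Fin m → ℚ) → Fin m → ℚ
partialSum c zero    = c zero
partialSum c (suc k) = c zero ℚ.+ partialSum (c ∘ suc) k

partialSum-step : ∀ {m} (c : Fin (suc m) → ℚ) i →
  partialSum c (suc i) ≡ partialSum c (inject₁ i) ℚ.+ c (suc i)
partialSum-step c zero    = refl
partialSum-step c (suc i) =
  trans (cong (c zero ℚ.+_) (partialSum-step (c ∘ suc) i)) (sym (ℚP.+-assoc (c zero) _ _))

increments : ∀ {m} → (Fin (suc m) → ℚ) → Fin (suc m) → ℚ
increments q zero    = q zero
increments q (suc i) = q (suc i) ℚ.- q (inject₁ i)

partialSum-increments : ∀ {m} (q : Fin (suc m) → ℚ) k → partialSum (increments q) k ≡ q k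
partialSum-increments q = <-weakInduction (λ k → partialSum (increments q) k ≡ q k) refl step
  where
  open +-*-Solver
  step : ∀ i → partialSum (increments q) (inject₁ i) ≡ q (inject₁ i) →
         partialSum (increments q) (suc i) ≡ q (suc i)
  step i ih = trans (partialSum-step (increments q) i)
    (trans (cong (ℚ._+ increments q (suc i)) ih)
           (solve 2 (λ x y → x :+ (y :- x) := y) refl (q (inject₁ i)) (q (suc i))))

increments-partialSum : ∀ {m} (c : Fin (suc m) → ℚ) k → increments (partialSum c) k ≡ c k
increments-partialSum c zero    = refl
increments-partialSum c (suc i) =
  trans (cong (ℚ._- partialSum c (inject₁ i)) (partialSum-step c i))
        (solve 2 (λ x y → (x :+ y) :- x := y) refl (partialSum c (inject₁ i)) (c (suc i)))
  where open +-*-Solver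

unitIncrements⇔partialSums : ∀ {m} (q : Fin (suc m) → ℚ) →
  (∀ k → InUnit (increments q k)) ⇔
  Σ (Fin (suc m) → ℚ) (λ c → (∀ j → InUnit (c j)) × (∀ k → q k ≡ partialSum c k))
unitIncrements⇔partialSums q = mk⇔
  (λ Δq∈ → increments q , Δq∈ , λ k → sym (partialSum-increments q k))
  (λ (c , c∈ , q≡Σc) k → subst InUnit (sym (Δq≡c c q≡Σc k)) (c∈ k))
  where
  Δq≡c : ∀ c → (∀ k → q k ≡ partialSum c k) → ∀ k → increments q k ≡ c k
  Δq≡c c q≡Σc zero    = q≡Σc zero
  Δq≡c c q≡Σc (suc i) =
    trans (cong₂ ℚ._-_ (q≡Σc (suc i)) (q≡Σc (inject₁ i))) (increments-partialSum c (suc i))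

prefixCount : ∀ {m} → (Fin m → Bool) → Fin (suc m) → ℕ
prefixCount b zero = 0
prefixCount {suc m} b (suc k) = bit (b zero) ℕ.+ prefixCount (b ∘ suc) k

prefixCount-step : ∀ {m} (b : Fin m → Bool) i →
  prefixCount b (suc i) ≡ prefixCount b (inject₁ i) ℕ.+ bit (b i)
prefixCount-step b zero    = ℕP.+-comm (bit (b zero)) 0
prefixCount-step b (suc i) =
  trans (cong (bit (b zero) ℕ.+_) (prefixCount-step (b ∘ suc) i)) (sym (ℕP.+-assoc (bit (b zero)) _ _))

prefixCount-last : ∀ {m} (b : Fin m → Bool) → prefixCount b (fromℕ m) ≡ countFin b
prefixCount-last {zero}  b = refl
prefixCount-last {suc m} b = cong (bit (b zero) ℕ.+_) (prefixCount-last (b ∘ suc))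

steps⇔prefixCount : ∀ {m} (a : Fin (suc m) → ℤ) (b : Fin m → Bool) →
  (a zero ≡ + 0 × (∀ i → a (suc i) ≡ a (inject₁ i) ℤ.+ + bit (b i))) ⇔
  (∀ k → a k ≡ + prefixCount b k)
steps⇔prefixCount a b = mk⇔
  (λ (a₀ , a-step) → <-weakInduction (λ k → a k ≡ + prefixCount b k) a₀ λ i ih →
     trans (a-step i) (trans (cong (ℤ._+ + bit (b i)) ih) (sym (+prefixCount-step i))))
  (λ a≡ → a≡ zero , λ i →
     trans (a≡ (suc i)) (trans (+prefixCount-step i) (cong (ℤ._+ + bit (b i)) (sym (a≡ (inject₁ i))))))
  where
  +prefixCount-step : ∀ i → + prefixCount b (suc i) ≡ + prefixCount b (inject₁ i) ℤ.+ + bit (b i)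
  +prefixCount-step i = trans (cong +_ (prefixCount-step b i)) (ℤP.pos-+ (prefixCount b (inject₁ i)) _)

lookup-ext : ∀ {A : Set} {n} {xs ys : Vec A n} → (∀ k → lookup xs k ≡ lookup ys k) → xs ≡ ys
lookup-ext {xs = xs} {ys} eq =
  trans (sym (VecP.tabulate∘lookup xs)) (trans (VecP.tabulate-cong eq) (VecP.tabulate∘lookup ys))

∀-Fin-suc-⇔ : ∀ {m} {P : Fin (suc m) → Set} {A : Set} {B : Fin m → Set} →
  P zero ⇔ A → (∀ i → P (suc i) ⇔ B i) → (∀ k → P k) ⇔ (A × (∀ i → B i))
∀-Fin-suc-⇔ P₀⇔A Pₛ⇔B = mk⇔
  (λ P → Equivalence.to P₀⇔A (P zero) , λ i → Equivalence.to (Pₛ⇔B i) (P (suc i)))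
  (λ { (a , b) zero → Equivalence.from P₀⇔A a ; (a , b) (suc i) → Equivalence.from (Pₛ⇔B i) (b i) })

sumℚ-cong : ∀ {m} {f g : Fin m → ℚ} → (∀ j → f j ≡ g j) → sumℚ f ≡ sumℚ g
sumℚ-cong {zero}  f≡g = refl
sumℚ-cong {suc m} f≡g = cong₂ ℚ._+_ (f≡g zero) (sumℚ-cong (f≡g ∘ suc))

sumℚ-*0 : ∀ {m} (c : Fin m → ℚ) → sumℚ (λ j → c j ℚ.* 0ℚ) ≡ 0ℚ
sumℚ-*0 {zero}  c = refl
sumℚ-*0 {suc m} c = trans (cong₂ ℚ._+_ (ℚP.*-zeroʳ (c zero)) (sumℚ-*0 (c ∘ suc))) (ℚP.+-identityʳ 0ℚ)

w-suc : ∀ {m} a (t : Vec ℕ m) j k → w (a ∷ t) (suc j) (suc k) ≡ w t j k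
w-suc a t zero    k = refl
w-suc a t (suc j) k = refl

coordinate-Σcw : ∀ {m} (t : Vec ℕ m) (c : Fin m → ℚ) k →
  sumℚ (λ j → c j ℚ.* w t j k) ≡ ι (+ lookup t k) ℚ.* partialSum c k
coordinate-Σcw (a ∷ t) c zero =
  trans (cong (c zero ℚ.* ι (+ a) ℚ.+_) (sumℚ-*0 (c ∘ suc)))
        (solve 2 (λ x y → x :* y :+ con 0ℚ := y :* x) refl (c zero) (ι (+ a)))
  where open +-*-Solver
coordinate-Σcw (a ∷ t) c (suc k) =
  trans (cong (c zero ℚ.* ι (+ lookup t k) ℚ.+_)
              (trans (sumℚ-cong (λ j → cong (c (suc j) ℚ.*_) (w-suc a t j k)))
                     (coordinate-Σcw t (c ∘ suc) k)))
        (solve 3 (λ x y z → x :* y :+ y :* z := y :* (x :+ z)) refl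
               (c zero) (ι (+ lookup t k)) (partialSum (c ∘ suc) k))
  where open +-*-Solver

module IntegerPoints {m : ℕ} (t : Vec ℕ (suc m)) (pos : Positive t) where

  rescaled : Vec ℤ (suc m) → Fin (suc m) → ℚ
  rescaled x k = (lookup x k / lookup t k) {{pos k}}

  -- x ∈ Par_t iff the increments of its rescaled coordinates all lie in [0,1):
  -- the coefficients c_j of x = Σ c_j w_j are exactly these increments.
  inPar⇔unitIncrements : ∀ x → InPar t x ⇔ (∀ k → InUnit (increments (rescaled x) k))
  inPar⇔unitIncrements x = ⇔-trans
    (mk⇔ (λ (c , c∈ , x≡) → c , c∈ , λ k → rescaled≡ c k (x≡ k))
         (λ (c , c∈ , q≡) → c , c∈ , λ k → x≡ c k (q≡ k)))
    (⇔-sym (unitIncrements⇔partialSums (rescaled x)))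
    where
    rescaled≡ : ∀ c k → ι (lookup x k) ≡ sumℚ (λ j → c j ℚ.* w t j k) →
                rescaled x k ≡ partialSum c k
    rescaled≡ c k x≡ = T*-injective (lookup t k) {{pos k}}
      (trans (sym (ι≡T*fraction (lookup x k) (lookup t k) {{pos k}}))
             (trans x≡ (coordinate-Σcw t c k)))
    x≡ : ∀ c k → rescaled x k ≡ partialSum c k → ι (lookup x k) ≡ sumℚ (λ j → c j ℚ.* w t j k)
    x≡ c k q≡ = trans (ι≡T*fraction (lookup x k) (lookup t k) {{pos k}})
      (trans (cong (ι (+ lookup t k) ℚ.*_) q≡) (sym (coordinate-Σcw t c k)))

  fractions : Vec ℕ (suc m) → Fin (suc m) → ℚ
  fractions r k = (+ lookup r k / lookup t k) {{pos k}}

  isDescent : Vec ℕ (suc m) → Fin m → Bool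
  isDescent r i = does (fractions r (suc i) ℚP.<? fractions r (inject₁ i))

  Remainders : Vec ℕ (suc m) → Set
  Remainders r = ∀ k → lookup r k ℕ.< lookup t k

  inPar⇔countsDescents : ∀ x (a : Fin (suc m) → ℤ) r →
    (∀ k → lookup x k ≡ + lookup r k ℤ.+ a k ℤ.* + lookup t k) → Remainders r →
    InPar t x ⇔ (∀ k → a k ≡ + prefixCount (isDescent r) k)
  inPar⇔countsDescents x a r x≡r+at r<t =
    ⇔-trans (inPar⇔unitIncrements x)
      (⇔-trans (∀-Fin-suc-⇔ first-step later-steps) (steps⇔prefixCount a (isDescent r)))
    where
    split : ∀ k → rescaled x k ≡ ι (a k) ℚ.+ fractions r k
    split k = trans (cong (λ z → (z / lookup t k) {{pos k}}) (x≡r+at k))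
                    (fraction-split (a k) (lookup r k) (lookup t k) {{pos k}})
    fraction∈ : ∀ k → InUnit (fractions r k)
    fraction∈ k = fraction-inUnit (lookup r k) (lookup t k) {{pos k}} (r<t k)
    first-step : InUnit (rescaled x zero) ⇔ (a zero ≡ + 0)
    first-step = ⇔-trans (InUnit-resp (split zero)) (shift-inUnit (fraction∈ zero) (a zero))
    later-steps : ∀ i → InUnit (rescaled x (suc i) ℚ.- rescaled x (inject₁ i)) ⇔
                        (a (suc i) ≡ a (inject₁ i) ℤ.+ + bit (isDescent r i))
    later-steps i = ⇔-trans (InUnit-resp (cong₂ ℚ._-_ (split (suc i)) (split (inject₁ i))))
                            (carry (a (inject₁ i)) (a (suc i)) (fraction∈ (inject₁ i)) (fraction∈ (suc i)))

  -- The inverse of REM_t on Par_t: entry k of lift r is r_k + (#descents of r before k)·t_k.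
  liftEntry : Vec ℕ (suc m) → Fin (suc m) → ℕ
  liftEntry r k = lookup r k ℕ.+ prefixCount (isDescent r) k ℕ.* lookup t k

  lift : Vec ℕ (suc m) → Vec ℤ (suc m)
  lift r = tabulate λ k → + liftEntry r k

  lookup-lift : ∀ r k →
    lookup (lift r) k ≡ + lookup r k ℤ.+ + prefixCount (isDescent r) k ℤ.* + lookup t k
  lookup-lift r k = begin
    lookup (lift r) k                                              ≡⟨ VecP.lookup∘tabulate (+_ ∘ liftEntry r) k ⟩
    + (lookup r k ℕ.+ prefixCount (isDescent r) k ℕ.* lookup t k)  ≡⟨ ℤP.pos-+ (lookup r k) _ ⟩
    + lookup r k ℤ.+ + (prefixCount (isDescent r) k ℕ.* lookup t k)
      ≡⟨ cong (ℤ._+_ (+ lookup r k)) (ℤP.pos-* (prefixCount (isDescent r) k) (lookup t k)) ⟩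
    + lookup r k ℤ.+ + prefixCount (isDescent r) k ℤ.* + lookup t k     ∎
    where open ≡-Reasoning

  lookup-REM : ∀ x k → lookup (REM t pos x) k ≡ (lookup x k %ℕ lookup t k) {{pos k}}
  lookup-REM x k = VecP.lookup∘tabulate (λ j → (lookup x j %ℕ lookup t j) {{pos j}}) k

  REM-remainders : ∀ x → Remainders (REM t pos x)
  REM-remainders x k = subst (ℕ._< lookup t k) (sym (lookup-REM x k))
                             (ℤD.n%ℕd<d (lookup x k) (lookup t k) {{pos k}})

  division : ∀ x k → lookup x k ≡
    + lookup (REM t pos x) k ℤ.+ (lookup x k /ℕ lookup t k) {{pos k}} ℤ.* + lookup t k
  division x k = trans (ℤD.a≡a%ℕn+[a/ℕn]*n (lookup x k) (lookup t k) {{pos k}})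
    (cong (λ z → + z ℤ.+ (lookup x k /ℕ lookup t k) {{pos k}} ℤ.* + lookup t k) (sym (lookup-REM x k)))

  lift-inPar : ∀ r → Remainders r → InPar t (lift r)
  lift-inPar r r<t =
    Equivalence.from (inPar⇔countsDescents (lift r) _ r (lookup-lift r) r<t) (λ k → refl)

  REM-lift : ∀ r → Remainders r → REM t pos (lift r) ≡ r
  REM-lift r r<t = lookup-ext λ k → begin
    lookup (REM t pos (lift r)) k                                    ≡⟨ lookup-REM (lift r) k ⟩
    (lookup (lift r) k %ℕ lookup t k) {{pos k}}
      ≡⟨ cong (λ z → (z %ℕ lookup t k) {{pos k}}) (VecP.lookup∘tabulate (+_ ∘ liftEntry r) k) ⟩
    ((lookup r k ℕ.+ prefixCount (isDescent r) k ℕ.* lookup t k) ℕ.% lookup t k) {{pos k}}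
      ≡⟨ ℕD.[m+kn]%n≡m%n (lookup r k) (prefixCount (isDescent r) k) (lookup t k) {{pos k}} ⟩
    (lookup r k ℕ.% lookup t k) {{pos k}}                            ≡⟨ ℕD.m<n⇒m%n≡m {{pos k}} (r<t k) ⟩
    lookup r k                                                       ∎
    where open ≡-Reasoning

  inPar⇒≡lift : ∀ x → InPar t x → x ≡ lift (REM t pos x)
  inPar⇒≡lift x x∈Par = lookup-ext λ k → begin
    lookup x k                                                         ≡⟨ division x k ⟩
    + lookup r k ℤ.+ quotient k ℤ.* + lookup t k
      ≡⟨ cong (λ a → + lookup r k ℤ.+ a ℤ.* + lookup t k) (quotients≡ k) ⟩
    + lookup r k ℤ.+ + prefixCount (isDescent r) k ℤ.* + lookup t k    ≡⟨ lookup-lift r k ⟨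
    lookup (lift r) k                                                  ∎
    where
    open ≡-Reasoning
    r : Vec ℕ (suc m)
    r = REM t pos x
    quotient : Fin (suc m) → ℤ
    quotient k = (lookup x k /ℕ lookup t k) {{pos k}}
    quotients≡ : ∀ k → quotient k ≡ + prefixCount (isDescent r) k
    quotients≡ = Equivalence.to (inPar⇔countsDescents x quotient r (division x) (REM-remainders x)) x∈Par

  lookup-lift-last : ∀ r → lookup (lift r) (fromℕ m) ≡
    + lookup r (fromℕ m) ℤ.+ + des t pos r ℤ.* + lookup t (fromℕ m)
  lookup-lift-last r = trans (lookup-lift r (fromℕ m))
    (cong (λ d → + lookup r (fromℕ m) ℤ.+ + d ℤ.* + lookup t (fromℕ m)) (prefixCount-last (isDescent r)))

lookup-∷ʳ-inject₁ : ∀ {A : Set} {n} (xs : Vec A n) a k → lookup (xs ∷ʳ a) (inject₁ k) ≡ lookup xs k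
lookup-∷ʳ-inject₁ (x ∷ xs) a zero    = refl
lookup-∷ʳ-inject₁ (x ∷ xs) a (suc k) = lookup-∷ʳ-inject₁ xs a k

lookup-∷ʳ-fromℕ : ∀ {A : Set} {n} (xs : Vec A n) a → lookup (xs ∷ʳ a) (fromℕ n) ≡ a
lookup-∷ʳ-fromℕ []       a = refl
lookup-∷ʳ-fromℕ (x ∷ xs) a = lookup-∷ʳ-fromℕ xs a

last≡lookup-fromℕ : ∀ {A : Set} {n} (xs : Vec A (suc n)) → last xs ≡ lookup xs (fromℕ n)
last≡lookup-fromℕ (x ∷ [])     = refl
last≡lookup-fromℕ (x ∷ y ∷ xs) = last≡lookup-fromℕ (y ∷ xs)

remainders⇒Ψ×0 : ∀ {n} (s : Vec ℕ n) r → (∀ k → lookup r k ℕ.< lookup (s ∷ʳ 1) k) → InΨ×0 s r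
remainders⇒Ψ×0 {n} s r r<s* =
  (λ k → subst (lookup r (inject₁ k) ℕ.<_) (lookup-∷ʳ-inject₁ s 1 k) (r<s* (inject₁ k))) ,
  trans (last≡lookup-fromℕ r)
        (ℕP.n<1⇒n≡0 (subst (lookup r (fromℕ n) ℕ.<_) (lookup-∷ʳ-fromℕ s 1) (r<s* (fromℕ n))))

Ψ×0⇒remainders : ∀ {n} (s : Vec ℕ n) r → InΨ×0 s r → ∀ k → lookup r k ℕ.< lookup (s ∷ʳ 1) k
Ψ×0⇒remainders []      (y ∷ [])    (_ , refl)       zero    = ℕ.s≤s ℕ.z≤n
Ψ×0⇒remainders (a ∷ s) (y ∷ z ∷ r) (r<s , r-last≡0) zero    = r<s zero
Ψ×0⇒remainders (a ∷ s) (y ∷ z ∷ r) (r<s , r-last≡0) (suc k) =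
  Ψ×0⇒remainders s (z ∷ r) (r<s ∘ suc , r-last≡0) k

module UnitLastModulus {n : ℕ} (s : Vec ℕ n) (pos : Positive s) where
  open IntegerPoints (s ∷ʳ 1) (positive-∷ʳ1 s pos) public

  REM-Ψ×0 : ∀ x → InΨ×0 s (REM (s ∷ʳ 1) (positive-∷ʳ1 s pos) x)
  REM-Ψ×0 x = remainders⇒Ψ×0 s _ (REM-remainders x)

  -- Since the last modulus is 1, the last coordinate of lift r is des_{s*}(r).
  last-lift : ∀ r → InΨ×0 s r → last (lift r) ≡ + des (s ∷ʳ 1) (positive-∷ʳ1 s pos) r
  last-lift r (_ , r-last≡0) = begin
    last (lift r)                                        ≡⟨ last≡lookup-fromℕ (lift r) ⟩
    lookup (lift r) (fromℕ n)                            ≡⟨ lookup-lift-last r ⟩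
    + lookup r (fromℕ n) ℤ.+ + d ℤ.* + lookup (s ∷ʳ 1) (fromℕ n)
      ≡⟨ cong₂ (λ u v → + u ℤ.+ + d ℤ.* + v)
               (trans (sym (last≡lookup-fromℕ r)) r-last≡0) (lookup-∷ʳ-fromℕ s 1) ⟩
    + 0 ℤ.+ + d ℤ.* + 1                                  ≡⟨ trans (ℤP.+-identityˡ _) (ℤP.*-identityʳ (+ d)) ⟩
    + d                                                  ∎
    where
    open ≡-Reasoning
    d : ℕ
    d = des (s ∷ʳ 1) (positive-∷ʳ1 s pos) r

  inPar⇒last≡des : ∀ x → InPar (s ∷ʳ 1) x →
    last x ≡ + des (s ∷ʳ 1) (positive-∷ʳ1 s pos) (REM (s ∷ʳ 1) (positive-∷ʳ1 s pos) x)
  inPar⇒last≡des x x∈Par = trans (cong last (inPar⇒≡lift x x∈Par)) (last-lift _ (REM-Ψ×0 x))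

HasCard-∩ : ∀ {A : Set} {P Q : A → Set} {k} → HasCard P k → Decidable Q →
  Σ ℕ (HasCard (λ a → P a × Q a))
HasCard-∩ {P = P} {Q} (L , L-unique , L-members , _) Q? =
  length (filter Q? L) , filter Q? L , UniqueP.filter⁺ Q? L-unique , members , refl
  where
  members : ∀ a → (a ∈ filter Q? L) ⇔ (P a × Q a)
  members a = mk⇔
    (λ a∈ → let (a∈L , Qa) = ∈-filter⁻ Q? a∈ in Equivalence.to (L-members a) a∈L , Qa)
    (λ (Pa , Qa) → ∈-filter⁺ Q? (Equivalence.from (L-members a) Pa) Qa)

HasCard-transfer : ∀ {A B : Set} {P : A → Set} {Q : B → Set} {k} (f : A → B) (g : B → A) →
  (∀ {a} → P a → Q (f a)) → (∀ {b} → Q b → P (g b)) →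
  (∀ {a} → P a → g (f a) ≡ a) → (∀ {b} → Q b → f (g b) ≡ b) →
  HasCard Q k → HasCard P k
HasCard-transfer {P = P} f g f-Q g-P g∘f f∘g (L , L-unique , L-members , L-length) =
  map g L , UniqueP.map⁻ (subst Unique (sym f∘g-on-L) L-unique) , members ,
  trans (length-map g L) L-length
  where
  f∘g-on-L : map f (map g L) ≡ L
  f∘g-on-L = trans (sym (map-∘ L))
    (map-id-local (All.tabulate λ b∈L → f∘g (Equivalence.to (L-members _) b∈L)))
  members : ∀ a → (a ∈ map g L) ⇔ P a
  members a = mk⇔
    (λ a∈ → let (b , b∈L , a≡gb) = ∈-map⁻ g a∈ in
            subst P (sym a≡gb) (g-P (Equivalence.to (L-members b) b∈L)))
    (λ Pa → subst (_∈ map g L) (g∘f Pa) (∈-map⁺ g (Equivalence.from (L-members (f a)) (f-Q Pa))))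

Ψ×0-list : ∀ {n} → Vec ℕ n → List (Vec ℕ (suc n))
Ψ×0-list []      = (0 ∷ []) ∷ []
Ψ×0-list (a ∷ s) = cartesianProductWith _∷_ (upTo a) (Ψ×0-list s)

Ψ×0-list-unique : ∀ {n} (s : Vec ℕ n) → Unique (Ψ×0-list s)
Ψ×0-list-unique []      = All.[] AllPairs.∷ AllPairs.[]
Ψ×0-list-unique (a ∷ s) = UniqueP.cartesianProductWith⁺ _∷_ VecP.∷-injective
  (UniqueP.upTo⁺ a) (Ψ×0-list-unique s)

∈-Ψ×0-list⇔ : ∀ {n} (s : Vec ℕ n) r → (r ∈ Ψ×0-list s) ⇔ InΨ×0 s r
∈-Ψ×0-list⇔ s r = mk⇔ (members s r) (members⁺ s r)
  where
  members : ∀ {n} (s : Vec ℕ n) r → r ∈ Ψ×0-list s → InΨ×0 s r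
  members []      (y ∷ [])    (here refl) = (λ ()) , refl
  members (a ∷ s) (y ∷ z ∷ r) r∈
    with y′ , r′ , y′∈ , r′∈ , eq ← ∈-cartesianProductWith⁻ _∷_ (upTo a) (Ψ×0-list s) r∈
    with refl , refl ← VecP.∷-injective eq
    = (λ { zero → ∈-upTo⁻ y′∈ ; (suc k) → proj₁ (members s (z ∷ r) r′∈) k }) ,
      proj₂ (members s (z ∷ r) r′∈)
  members⁺ : ∀ {n} (s : Vec ℕ n) r → InΨ×0 s r → r ∈ Ψ×0-list s
  members⁺ []      (y ∷ [])    (_ , refl)       = here refl
  members⁺ (a ∷ s) (y ∷ z ∷ r) (r<s , r-last≡0) =
    ∈-cartesianProductWith⁺ _∷_ (∈-upTo⁺ (r<s zero)) (members⁺ s (z ∷ r) (r<s ∘ suc , r-last≡0))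

Ψ×0-hasCard : ∀ {n} (s : Vec ℕ n) → HasCard (InΨ×0 s) (length (Ψ×0-list s))
Ψ×0-hasCard s = Ψ×0-list s , Ψ×0-list-unique s , ∈-Ψ×0-list⇔ s , refl

corollary3p8 : (n : ℕ) (s : Vec ℕ n) (pos : Positive s) (i : ℕ) →
    let s* = s ∷ʳ 1
        pos* = positive-∷ʳ1 s pos
    in ((x : Vec ℤ (suc n)) →
          (InPar s* x × last x ≡ + i) ⇔ (InPar s* x × des s* pos* (REM s* pos* x) ≡ i))
       × ((x : Vec ℤ (suc n)) →
          (InPar s* x × des s* pos* (REM s* pos* x) ≡ i)
            ⇔ (Σ (Vec ℕ (suc n)) λ r →
                 InΨ×0 s r × des s* pos* r ≡ i × InPar s* x × REM s* pos* x ≡ r))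
       × ((r : Vec ℕ (suc n)) → InΨ×0 s r → des s* pos* r ≡ i →
            ∃ λ (x : Vec ℤ (suc n)) → InPar s* x × REM s* pos* x ≡ r)
       × (Σ ℕ λ k →
            HasCard (λ (x : Vec ℤ (suc n)) → InPar s* x × last x ≡ + i) k
            × HasCard (λ (r : Vec ℕ (suc n)) → InΨ×0 s r × des s* pos* r ≡ i) k)
corollary3p8 n s pos i =
    (λ x → mk⇔ (λ (x∈ , last≡i) → x∈ , ℤP.+-injective (trans (sym (inPar⇒last≡des x x∈)) last≡i))
               (λ (x∈ , des≡i) → x∈ , trans (inPar⇒last≡des x x∈) (cong +_ des≡i)))
  , (λ x → mk⇔ (λ (x∈ , des≡i) → _ , REM-Ψ×0 x , des≡i , x∈ , refl)
               (λ { (_ , _ , des≡i , x∈ , refl) → x∈ , des≡i }))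
  , (λ r r∈ _ → lift r , lift-inPar r (Ψ×0⇒remainders s r r∈) , REM-lift r (Ψ×0⇒remainders s r r∈))
  , proj₁ counted
  , HasCard-transfer (REM (s ∷ʳ 1) (positive-∷ʳ1 s pos)) lift
      (λ {x} (x∈ , last≡i) → REM-Ψ×0 x , ℤP.+-injective (trans (sym (inPar⇒last≡des x x∈)) last≡i))
      (λ {r} (r∈ , des≡i) → lift-inPar r (Ψ×0⇒remainders s r r∈) ,
                            trans (last-lift r r∈) (cong +_ des≡i))
      (λ {x} (x∈ , _) → sym (inPar⇒≡lift x x∈))
      (λ {r} (r∈ , _) → REM-lift r (Ψ×0⇒remainders s r r∈))
      (proj₂ counted)
  , proj₂ counted
  where
  open UnitLastModulus s pos
  counted : Σ ℕ (HasCard (λ r → InΨ×0 s r × des (s ∷ʳ 1) (positive-∷ʳ1 s pos) r ≡ i))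
  counted = HasCard-∩ (Ψ×0-hasCard s) (λ r → des (s ∷ʳ 1) (positive-∷ʳ1 s pos) r ℕ.≟ i)
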